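{- Let $T$ be a string and $a$ a character such that $aT$ contains at least two distinct characters, and let $x$ be a string. If $ax \notin \mathsf{M}(T)$ and $ax \in \mathsf{M}(aT)$, then $d_{aT}(x) = d_T(x)$.
   Context: Strings are finite sequences of characters from an alphabet $\Sigma$; $\varepsilon$ is the empty string. For a string $T$, $\mathrm{Substr}(T)$ is its set of substrings (including $\varepsilon$). A substring $u$ of $T$ is left-maximal in $T$ if $u$ is a prefix of $T$ or there are distinct characters $c \neq d$ with $cu, du \in \mathrm{Substr}(T)$; it is right-maximal in $T$ if $u$ is a suffix of $T$ or there are distinct characters $c\neq d$ with $uc, ud \in \mathrm{Substr}(T)$. $\mathsf{M}(T)$ is the set of substrings of $T$ that are both left- and right-maximal. For a string $w$, $d_T(w)$ is the number of distinct characters $c$ with $wc \in \mathrm{Substr}(T)$. -}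

module Defs where

open import Data.List using (List; []; _∷_; _++_; [_]; length)
open import Data.List.Membership.Propositional using (_∈_)
open import Data.List.Relation.Unary.Unique.Propositional using (Unique)
open import Data.Product using (Σ; ∃; ∃-syntax; _×_; _,_)
open import Data.Sum using (_⊎_)
open import Data.Nat using (ℕ)
open import Relation.Binary.PropositionalEquality using (_≡_; _≢_)
open import Relation.Nullary using (¬_)
open import Function.Bundles using (_⇔_)

module _ {A : Set} where

  Str : Set
  Str = List A

  Substr : Str → Str → Set
  Substr T u = ∃[ p ] ∃[ s ] T ≡ p ++ u ++ s

  IsPrefix : Str → Str → Set
  IsPrefix T u = ∃[ s ] T ≡ u ++ s

  IsSuffix : Str → Str → Set
  IsSuffix T u = ∃[ p ] T ≡ p ++ u

  LeftMaximal : Str → Str → Set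
  LeftMaximal T u = Substr T u ×
    (IsPrefix T u ⊎ ∃[ c ] ∃[ d ] (c ≢ d × Substr T (c ∷ u) × Substr T (d ∷ u)))

  RightMaximal : Str → Str → Set
  RightMaximal T u = Substr T u ×
    (IsSuffix T u ⊎ ∃[ c ] ∃[ d ] (c ≢ d × Substr T (u ++ [ c ]) × Substr T (u ++ [ d ])))

  M : Str → Str → Set
  M T u = LeftMaximal T u × RightMaximal T u

  -- d_T(w) ≡ n : n is the number of distinct characters c with wc ∈ Substr(T),
  -- witnessed by a duplicate-free list enumerating exactly those characters.
  Ext : Str → Str → List A → Set
  Ext T w L = Unique L × (∀ c → (c ∈ L) ⇔ Substr T (w ++ [ c ]))

  d≡ : Str → Str → ℕ → Set
  d≡ T w n = ∃[ L ] (Ext T w L × length L ≡ n)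

  TwoDistinct : Str → Set
  TwoDistinct T = ∃[ c ] ∃[ d ] (c ≢ d × c ∈ T × d ∈ T)

-- Every occurrence of a string in a T other than as its prefix is an occurrence in T.
-- So d_T(x) can only drop if x c is a prefix of a T; and a x, being in M(a T) but
-- not in M(T), must owe one of its maximality witnesses to position 0, so a x is a
-- prefix of a T as well. Equal-length prefixes coincide: a x = x c, whence a x is a
-- power of a. Right-maximality of a x in a T now yields an occurrence of a x = x c
-- in T, the remaining case a x = a T being excluded because a T is not a power of a.
module Submission where

open import Defs
open import Data.List using (List; []; _∷_; _++_; [_]; length)
open import Data.List.Properties using (++-assoc; ++-cancelˡ; ++-identityʳ; ∷-injectiveˡ; ∷-injectiveʳ; length-++)
open import Data.List.Membership.Propositional using (_∈_)
open import Data.List.Membership.Propositional.Properties.WithK using (unique∧set⇒bag)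
open import Data.List.Relation.Unary.Any using (here; there)
open import Data.List.Relation.Binary.BagAndSetEquality using (∼bag⇒↭)
open import Data.List.Relation.Binary.Permutation.Propositional.Properties using (↭-length)
open import Data.Nat using (ℕ; pred)
open import Data.Nat.Properties using (+-comm)
open import Data.Product using (_,_; proj₂)
open import Data.Sum using (_⊎_; inj₁; inj₂; [_,_]′)
open import Data.Empty using (⊥-elim)
open import Function.Base using (id)
open import Function.Bundles using (_⇔_; mk⇔)
open import Function.Properties.Equivalence using () renaming (sym to ⇔-sym; trans to ⇔-trans)
open import Relation.Binary.PropositionalEquality using (_≡_; refl; sym; trans; cong; cong₂; subst)
open import Relation.Nullary using (¬_)

module _ {A : Set} where

  substr-∷⁺ : ∀ {T u} {a : A} → Substr T u → Substr (a ∷ T) u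
  substr-∷⁺ {a = a} (p , s , eq) = a ∷ p , s , cong (a ∷_) eq

  substr-++⁻ˡ : ∀ {T : List A} u v → Substr T (u ++ v) → Substr T u
  substr-++⁻ˡ u v (p , s , eq) = p , v ++ s , trans eq (cong (p ++_) (++-assoc u v s))

  substr-∷⁻ʳ : ∀ {T u} {c : A} → Substr T (c ∷ u) → Substr T u
  substr-∷⁻ʳ {u = u} {c} (p , s , eq) = p ++ [ c ] , s , trans eq (sym (++-assoc p [ c ] (u ++ s)))

  prefix⇒substr : ∀ {T u : List A} → IsPrefix T u → Substr T u
  prefix⇒substr (s , eq) = [] , s , eq

  suffix⇒substr : ∀ {T u : List A} → IsSuffix T u → Substr T u
  suffix⇒substr {u = u} (p , eq) = p , [] , trans eq (cong (p ++_) (sym (++-identityʳ u)))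

  prefix-++⁻ : ∀ {T : List A} u v → IsPrefix T (u ++ v) → IsPrefix T u
  prefix-++⁻ u v (s , eq) = v ++ s , trans eq (++-assoc u v s)

  prefix-length-unique : ∀ {T u v : List A} → IsPrefix T u → IsPrefix T v →
                         length u ≡ length v → u ≡ v
  prefix-length-unique {u = []}    {[]}    _ _ _ = refl
  prefix-length-unique {u = _ ∷ u} {_ ∷ v} (r , refl) (s , eq) len =
    cong₂ _∷_ (∷-injectiveˡ eq) (prefix-length-unique (r , refl) (s , ∷-injectiveʳ eq) (cong pred len))

  substr-∷⁻ : ∀ {T u} {a : A} → Substr (a ∷ T) u → IsPrefix (a ∷ T) u ⊎ Substr T u
  substr-∷⁻ ([]    , s , eq) = inj₁ (s , eq)
  substr-∷⁻ (_ ∷ p , s , eq) = inj₂ (p , s , ∷-injectiveʳ eq)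

  prefix-∷⁻ : ∀ {T u} {a c : A} → IsPrefix (a ∷ T) (c ∷ u) → IsPrefix T u
  prefix-∷⁻ (s , eq) = s , ∷-injectiveʳ eq

  leftMaximal-∷⁻ : ∀ {T u} {a : A} → LeftMaximal (a ∷ T) u → IsPrefix (a ∷ T) u ⊎ LeftMaximal T u
  leftMaximal-∷⁻ (_ , inj₁ pre) = inj₁ pre
  leftMaximal-∷⁻ (_ , inj₂ (c , d , c≢d , cu , du)) with substr-∷⁻ cu | substr-∷⁻ du
  ... | inj₁ pre | _        = inj₂ (prefix⇒substr (prefix-∷⁻ pre) , inj₁ (prefix-∷⁻ pre))
  ... | inj₂ _   | inj₁ pre = inj₂ (prefix⇒substr (prefix-∷⁻ pre) , inj₁ (prefix-∷⁻ pre))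
  ... | inj₂ cu′ | inj₂ du′ = inj₂ (substr-∷⁻ʳ cu′ , inj₂ (c , d , c≢d , cu′ , du′))

  rightMaximal-∷⁻ : ∀ {T u} {a : A} → RightMaximal (a ∷ T) u → IsPrefix (a ∷ T) u ⊎ RightMaximal T u
  rightMaximal-∷⁻ {u = u} (_ , inj₁ ([] , eq)) = inj₁ ([] , trans eq (sym (++-identityʳ u)))
  rightMaximal-∷⁻ (_ , inj₁ (_ ∷ p , eq)) = inj₂ (suffix⇒substr (p , ∷-injectiveʳ eq) , inj₁ (p , ∷-injectiveʳ eq))
  rightMaximal-∷⁻ {u = u} (_ , inj₂ (c , d , c≢d , uc , ud)) with substr-∷⁻ uc | substr-∷⁻ ud
  ... | inj₁ pre | _        = inj₁ (prefix-++⁻ u [ c ] pre)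
  ... | inj₂ _   | inj₁ pre = inj₁ (prefix-++⁻ u [ d ] pre)
  ... | inj₂ uc′ | inj₂ ud′ = inj₂ (substr-++⁻ˡ u [ c ] uc′ , inj₂ (c , d , c≢d , uc′ , ud′))

  M-∷⁻ : ∀ {T u} {a : A} → M (a ∷ T) u → IsPrefix (a ∷ T) u ⊎ M T u
  M-∷⁻ (lm , rm) with leftMaximal-∷⁻ lm | rightMaximal-∷⁻ rm
  ... | inj₁ pre | _        = inj₁ pre
  ... | inj₂ _   | inj₁ pre = inj₁ pre
  ... | inj₂ lm′ | inj₂ rm′ = inj₂ (lm′ , rm′)

  -- Two distinct right extensions cannot both be prefixes of a ∷ T.
  rightMaximal-∷⇒substr : ∀ {T u} {a : A} → RightMaximal (a ∷ T) u → u ≡ a ∷ T ⊎ Substr T u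
  rightMaximal-∷⇒substr (_ , inj₁ ([] , eq)) = inj₁ (sym eq)
  rightMaximal-∷⇒substr (_ , inj₁ (_ ∷ p , eq)) = inj₂ (suffix⇒substr (p , ∷-injectiveʳ eq))
  rightMaximal-∷⇒substr {u = u} (_ , inj₂ (c , d , c≢d , uc , ud)) with substr-∷⁻ uc | substr-∷⁻ ud
  ... | inj₁ uc-pre | inj₁ ud-pre = ⊥-elim (c≢d (∷-injectiveˡ (++-cancelˡ u [ c ] [ d ] uc≡ud)))
    where
    uc≡ud : u ++ [ c ] ≡ u ++ [ d ]
    uc≡ud = prefix-length-unique uc-pre ud-pre (trans (length-++ u) (sym (length-++ u)))
  ... | inj₂ uc′    | _          = inj₂ (substr-++⁻ˡ u [ c ] uc′)
  ... | inj₁ _      | inj₂ ud′   = inj₂ (substr-++⁻ˡ u [ d ] ud′)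

  ∷≡∷ʳ⇒constant : ∀ {a c : A} x → a ∷ x ≡ x ++ [ c ] → ∀ {y} → y ∈ a ∷ x → y ≡ a
  ∷≡∷ʳ⇒constant []      _  (here y≡a) = y≡a
  ∷≡∷ʳ⇒constant (_ ∷ _) _  (here y≡a) = y≡a
  ∷≡∷ʳ⇒constant (b ∷ x) eq (there y∈) =
    trans (∷≡∷ʳ⇒constant x (∷-injectiveʳ eq) y∈) (sym (∷-injectiveˡ eq))

  ∷≡∷ʳ⇒¬twoDistinct : ∀ {a c : A} x → a ∷ x ≡ x ++ [ c ] → ¬ TwoDistinct (a ∷ x)
  ∷≡∷ʳ⇒¬twoDistinct x eq (c , d , c≢d , c∈ , d∈) =
    c≢d (trans (∷≡∷ʳ⇒constant x eq c∈) (sym (∷≡∷ʳ⇒constant x eq d∈)))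

  extension-∷⁻ : ∀ T (a : A) x {c} → TwoDistinct (a ∷ T) → ¬ M T (a ∷ x) → M (a ∷ T) (a ∷ x) →
                 Substr (a ∷ T) (x ++ [ c ]) → Substr T (x ++ [ c ])
  extension-∷⁻ T a x {c} twoDistinct ax∉M ax∈M xc-in-aT with substr-∷⁻ xc-in-aT | M-∷⁻ ax∈M
  ... | inj₂ xc-in-T | _          = xc-in-T
  ... | inj₁ _       | inj₂ ax∈MT = ⊥-elim (ax∉M ax∈MT)
  ... | inj₁ xc-pre  | inj₁ ax-pre = subst (Substr T) ax≡xc ax-in-T
    where
    ax≡xc : a ∷ x ≡ x ++ [ c ]
    ax≡xc = prefix-length-unique ax-pre xc-pre (sym (trans (length-++ x) (+-comm (length x) 1)))
    ax-in-T : Substr T (a ∷ x)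
    ax-in-T = [ (λ ax≡aT → ⊥-elim (∷≡∷ʳ⇒¬twoDistinct x ax≡xc (subst TwoDistinct (sym ax≡aT) twoDistinct)))
              , id
              ]′ (rightMaximal-∷⇒substr (proj₂ ax∈M))

  d≡-resp-extensions : ∀ {T T′ w w′ : List A} {m n} → (∀ c → Substr T (w ++ [ c ]) ⇔ Substr T′ (w′ ++ [ c ])) →
                       d≡ T w m → d≡ T′ w′ n → m ≡ n
  d≡-resp-extensions ext (L , (L! , L⇔) , refl) (L′ , (L′! , L′⇔) , refl) =
    ↭-length (∼bag⇒↭ (unique∧set⇒bag L! L′! λ {c} → ⇔-trans (L⇔ c) (⇔-trans (ext c) (⇔-sym (L′⇔ c)))))

lemma6 : {A : Set} (T : List A) (a : A) (x : List A) →
    TwoDistinct (a ∷ T) →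
    ¬ M T (a ∷ x) →
    M (a ∷ T) (a ∷ x) →
    (m n : ℕ) → d≡ (a ∷ T) x m → d≡ T x n → m ≡ n
lemma6 T a x twoDistinct ax∉M ax∈M _ _ =
  d≡-resp-extensions λ c → mk⇔ (extension-∷⁻ T a x twoDistinct ax∉M ax∈M) substr-∷⁺
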